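{- Let $G$ be a graph and let $H$ be obtained from $G$ by adding a pendant edge. If $B(G)$ is signed-graphic, then $B(H)$ is signed-graphic.
   Context: Graphs may have loops and multiple edges. Adding a pendant edge means adding a new vertex together with an edge joining it to an existing vertex. The bicircular matroid $B(G)$ is the matroid on $E(G)$ whose independent sets are the edge sets spanning subgraphs with at most one cycle in each component. A signed graph is a graph with each edge labelled $+1$ or $-1$; a circle is positive if the product of its edge signs is $1$, negative otherwise. Its frame matroid is the matroid on the edge set whose independent sets are those spanning subgraphs with no positive circle and at most one negative circle in each component. A matroid is signed-graphic if it is isomorphic to the frame matroid of some signed graph. -}

module Defs where

open import Data.Nat using (ℕ; zero; suc)
open import Data.Fin using (Fin; zero; suc; _≟_)
open import Data.Bool using (Bool; true; false; if_then_else_)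
open import Data.Product using (Σ; ∃; _×_; _,_; proj₁; proj₂)
open import Data.Sum using (_⊎_)
open import Data.List using (List; map; foldr; allFin)
open import Data.Nat.ListAction using (sum)
open import Data.Sign as Sign using (Sign)
open import Relation.Nullary using (¬_; yes; no)
open import Relation.Binary.PropositionalEquality using (_≡_; _≢_)
open import Function using (_∘_)
open import Function.Bundles using (_⤖_; _⇔_; Bijection)

-- A finite graph; loops (ends e = (u , u)) and parallel edges allowed.
record Graph : Set where
  field
    nV   : ℕ
    nE   : ℕ
    ends : Fin nE → Fin nV × Fin nV
open Graph public

EdgeSet : Graph → Set
EdgeSet G = Fin (nE G) → Bool

Sub : (G : Graph) → EdgeSet G → EdgeSet G → Set
Sub G C X = ∀ (e : Fin (nE G)) → C e ≡ true → X e ≡ true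

SameSet : (G : Graph) → EdgeSet G → EdgeSet G → Set
SameSet G C D = ∀ (e : Fin (nE G)) → C e ≡ D e

-- number of ends of an edge at vertex v (a loop at v counts 2)
incid : {n : ℕ} → Fin n → Fin n × Fin n → ℕ
incid v (a , b) = (if a ≟' v then 1 else 0) Data.Nat.+ (if b ≟' v then 1 else 0)
  where
  _≟'_ : {n : ℕ} → Fin n → Fin n → Bool
  x ≟' y with x ≟ y
  ... | yes _ = true
  ... | no  _ = false

deg : (G : Graph) → EdgeSet G → Fin (nV G) → ℕ
deg G X v = sum (map (λ e → if X e then incid v (ends G e) else 0) (allFin (nE G)))

Joins : {n : ℕ} → Fin n × Fin n → Fin n → Fin n → Set
Joins (a , b) u w = (a ≡ u × b ≡ w) ⊎ (b ≡ u × a ≡ w)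

data Reach (G : Graph) (X : EdgeSet G) : Fin (nV G) → Fin (nV G) → Set where
  here : ∀ {u} → Reach G X u u
  step : ∀ {u v w} (e : Fin (nE G)) → X e ≡ true → Joins (ends G e) u v →
         Reach G X v w → Reach G X u w

Circle : (G : Graph) → EdgeSet G → Set
Circle G C =
  (∃ λ e → C e ≡ true) ×
  (∀ v → deg G C v ≡ 0 ⊎ deg G C v ≡ 2) ×
  (∀ u v → deg G C u ≢ 0 → deg G C v ≢ 0 → Reach G C u v)

SameComponent : (G : Graph) → EdgeSet G → EdgeSet G → EdgeSet G → Set
SameComponent G X C D =
  Σ (Fin (nV G)) λ u → Σ (Fin (nV G)) λ v →
    deg G C u ≢ 0 × deg G D v ≢ 0 × Reach G X u v

BicircularIndep : (G : Graph) → EdgeSet G → Set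
BicircularIndep G X =
  ∀ C D → Circle G C → Circle G D → Sub G C X → Sub G D X →
  SameComponent G X C D → SameSet G C D

record SignedGraph : Set where
  field
    graph : Graph
    sign  : Fin (nE graph) → Sign
open SignedGraph public

signOf : (S : SignedGraph) → EdgeSet (graph S) → Sign
signOf S C = foldr Sign._*_ Sign.+
  (map (λ e → if C e then sign S e else Sign.+) (allFin (nE (graph S))))

PositiveCircle NegativeCircle : (S : SignedGraph) → EdgeSet (graph S) → Set
PositiveCircle S C = Circle (graph S) C × signOf S C ≡ Sign.+
NegativeCircle S C = Circle (graph S) C × signOf S C ≡ Sign.-

FrameIndep : (S : SignedGraph) → EdgeSet (graph S) → Set
FrameIndep S X =
  (∀ C → PositiveCircle S C → ¬ Sub (graph S) C X) ×
  (∀ C D → NegativeCircle S C → NegativeCircle S D → Sub (graph S) C X → Sub (graph S) D X →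
     SameComponent (graph S) X C D → SameSet (graph S) C D)

SignedGraphic : {m : ℕ} → ((Fin m → Bool) → Set) → Set
SignedGraphic {m} Ind =
  Σ SignedGraph λ S → Σ (Fin m ⤖ Fin (nE (graph S))) λ f →
    ∀ (Y : EdgeSet (graph S)) → FrameIndep S Y ⇔ Ind (Y ∘ Bijection.to f)

-- H obtained from G by adding a pendant edge at v:
-- new vertex is zero (old vertices shifted by suc), new edge is zero.
addPendant : (G : Graph) → Fin (nV G) → Graph
addPendant G v = record
  { nV = suc (nV G)
  ; nE = suc (nE G)
  ; ends = λ { zero → (suc v , zero)
             ; (suc e) → (suc (proj₁ (ends G e)) , suc (proj₂ (ends G e))) } }

-- A circle never passes through a vertex of degree one, so the circles of H are exactly the
-- circles of G, and the pendant edge is a coloop of B(H): B(H) = B(G) ⊕ coloop. If B(G) is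
-- the frame matroid of a signed graph Σ, attach a positive pendant edge to any vertex of Σ;
-- its frame matroid is likewise that of Σ plus a coloop. If Σ has no vertex at all, then G
-- has no edges, H has no circles, and B(H) is free, hence the frame matroid of H with all
-- edges positive.
module Submission where

open import Defs
open import Data.Nat using (ℕ; zero; suc; _+_)
open import Data.Nat.Properties using (+-identityʳ)
open import Data.Nat.ListAction using (sum)
open import Data.Fin using (Fin; zero; suc; _≟_)
open import Data.Fin.Properties using (suc-injective; ¬Fin0)
open import Data.Bool using (Bool; true; false; if_then_else_)
open import Data.Product using (∃; _×_; _,_; proj₁; proj₂)
open import Data.Product.Function.NonDependent.Propositional using (_×-⇔_)
open import Data.Sum using (_⊎_; inj₁; inj₂)
open import Data.List using ([]; _∷_; map; foldr; allFin; tabulate)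
open import Data.List.Properties using (map-tabulate; map-cong)
open import Data.Vec.Functional as Vector using ()
open import Data.Sign as Sign using (Sign)
open import Data.Empty using (⊥-elim)
open import Relation.Nullary using (¬_; yes; no)
open import Relation.Binary.PropositionalEquality
  using (_≡_; _≢_; refl; trans; sym; cong; cong₂; subst)
open import Function using (_∘_; id)
open import Function.Bundles using (_⤖_; _⇔_; mk⤖; mk⇔; Bijection)
open import Function.Consequences.Propositional using (strictlySurjective⇒surjective)
open import Function.Construct.Composition using (_⇔-∘_)
open import Function.Construct.Identity using (⤖-id)
open import Function.Construct.Symmetry using (⇔-sym)

sum-allFin-suc : ∀ {n} (f : Fin (suc n) → ℕ) →
  sum (map f (allFin (suc n))) ≡ f zero + sum (map (f ∘ suc) (allFin n))
sum-allFin-suc f = cong (f zero +_) (cong sum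
  (trans (map-tabulate suc f) (sym (map-tabulate id (f ∘ suc)))))

sum-map-zero : ∀ {A : Set} (f : A → ℕ) → (∀ x → f x ≡ 0) → ∀ xs → sum (map f xs) ≡ 0
sum-map-zero f f≡0 []       = refl
sum-map-zero f f≡0 (x ∷ xs) = cong₂ _+_ (f≡0 x) (sum-map-zero f f≡0 xs)

if-0 : ∀ (b : Bool) → (if b then 0 else 0) ≡ 0
if-0 true  = refl
if-0 false = refl

incid-suc : ∀ {n} (u a b : Fin n) → incid (suc u) (suc a , suc b) ≡ incid u (a , b)
incid-suc u a b with a ≟ u | b ≟ u
... | yes _ | yes _ = refl
... | yes _ | no _  = refl
... | no _  | yes _ = refl
... | no _  | no _  = refl

indicator-0-or-2⇒false : ∀ (b : Bool) {d : ℕ} →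
  d ≡ (if b then 1 else 0) → d ≡ 0 ⊎ d ≡ 2 → b ≡ false
indicator-0-or-2⇒false false _    _        = refl
indicator-0-or-2⇒false true  refl (inj₁ ())
indicator-0-or-2⇒false true  refl (inj₂ ())

NoneContained : (G : Graph) → (EdgeSet G → Set) → EdgeSet G → Set
NoneContained G Q X = ∀ C → Q C → ¬ Sub G C X

AtMostOnePerComponent : (G : Graph) → (EdgeSet G → Set) → EdgeSet G → Set
AtMostOnePerComponent G Q X =
  ∀ C D → Q C → Q D → Sub G C X → Sub G D X → SameComponent G X C D → SameSet G C D

module Pendant (G : Graph) (v : Fin (nV G)) where

  H : Graph
  H = addPendant G v

  deg-pendant : ∀ C → deg H C zero ≡ (if C zero then 1 else 0)
  deg-pendant C = trans (sum-allFin-suc f)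
    (trans (cong (f zero +_) (sum-map-zero (f ∘ suc) (λ e → if-0 (C (suc e))) (allFin (nE G))))
           (+-identityʳ (f zero)))
    where
    f : Fin (nE H) → ℕ
    f e = if C e then incid zero (ends H e) else 0

  deg-old : ∀ C → C zero ≡ false → ∀ u → deg H C (suc u) ≡ deg G (C ∘ suc) u
  deg-old C C₀≡false u = trans (sum-allFin-suc f)
    (cong₂ _+_ (cong (λ b → if b then incid (suc u) (suc v , zero) else 0) C₀≡false)
               (cong sum (map-cong incidence-suc (allFin (nE G)))))
    where
    f : Fin (nE H) → ℕ
    f e = if C e then incid (suc u) (ends H e) else 0
    incidence-suc : ∀ e → f (suc e) ≡ (if C (suc e) then incid u (ends G e) else 0)
    incidence-suc e = cong (λ n → if C (suc e) then n else 0)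
      (incid-suc u (proj₁ (ends G e)) (proj₂ (ends G e)))

  deg-pendant-≡0 : ∀ C → C zero ≡ false → deg H C zero ≡ 0
  deg-pendant-≡0 C C₀≡false = trans (deg-pendant C) (cong (λ b → if b then 1 else 0) C₀≡false)

  -- Walks through the pendant vertex are mapped to walks through its attachment vertex v.
  collapse : Fin (nV H) → Fin (nV G)
  collapse zero    = v
  collapse (suc u) = u

  reach-restrict : ∀ {X a b} → Reach H X a b → Reach G (X ∘ suc) (collapse a) (collapse b)
  reach-restrict here = here
  reach-restrict (step zero    _   (inj₁ (refl , refl)) r) = reach-restrict r
  reach-restrict (step zero    _   (inj₂ (refl , refl)) r) = reach-restrict r
  reach-restrict (step (suc e) X∋e (inj₁ (refl , refl)) r) =
    step e X∋e (inj₁ (refl , refl)) (reach-restrict r)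
  reach-restrict (step (suc e) X∋e (inj₂ (refl , refl)) r) =
    step e X∋e (inj₂ (refl , refl)) (reach-restrict r)

  reach-extend : ∀ {X u w} → Reach G (X ∘ suc) u w → Reach H X (suc u) (suc w)
  reach-extend here = here
  reach-extend (step e X∋e (inj₁ (refl , refl)) r) =
    step (suc e) X∋e (inj₁ (refl , refl)) (reach-extend r)
  reach-extend (step e X∋e (inj₂ (refl , refl)) r) =
    step (suc e) X∋e (inj₂ (refl , refl)) (reach-extend r)

  circle-avoids-pendant : ∀ {C} → Circle H C → C zero ≡ false
  circle-avoids-pendant {C} (_ , deg-0-or-2 , _) =
    indicator-0-or-2⇒false (C zero) (deg-pendant C) (deg-0-or-2 zero)

  circle-restrict : ∀ {C} → Circle H C → Circle G (C ∘ suc)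
  circle-restrict {C} circle@((e , C∋e) , deg-0-or-2 , connected) =
    old-edge e C∋e ,
    (λ u → subst (λ d → d ≡ 0 ⊎ d ≡ 2) (deg-old C C₀≡false u) (deg-0-or-2 (suc u))) ,
    λ u w du dw → reach-restrict (connected (suc u) (suc w)
      (du ∘ trans (sym (deg-old C C₀≡false u))) (dw ∘ trans (sym (deg-old C C₀≡false w))))
    where
    C₀≡false : C zero ≡ false
    C₀≡false = circle-avoids-pendant circle
    old-edge : ∀ e → C e ≡ true → ∃ λ e′ → C (suc e′) ≡ true
    old-edge zero    C∋e with () ← trans (sym C₀≡false) C∋e
    old-edge (suc e) C∋e = e , C∋e

  circle-extend : ∀ {C} → Circle G C → Circle H (false Vector.∷ C)
  circle-extend {C} ((e , C∋e) , deg-0-or-2 , connected) = (suc e , C∋e) , deg-0-or-2′ , connected′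
    where
    C′ : EdgeSet H
    C′ = false Vector.∷ C
    deg-0-or-2′ : ∀ u → deg H C′ u ≡ 0 ⊎ deg H C′ u ≡ 2
    deg-0-or-2′ zero    = inj₁ (deg-pendant C′)
    deg-0-or-2′ (suc u) = subst (λ d → d ≡ 0 ⊎ d ≡ 2) (sym (deg-old C′ refl u)) (deg-0-or-2 u)
    connected′ : ∀ u w → deg H C′ u ≢ 0 → deg H C′ w ≢ 0 → Reach H C′ u w
    connected′ zero    _       du _  = ⊥-elim (du (deg-pendant C′))
    connected′ (suc u) zero    _  dw = ⊥-elim (dw (deg-pendant C′))
    connected′ (suc u) (suc w) du dw = reach-extend (connected u w
      (du ∘ trans (deg-old C′ refl u)) (dw ∘ trans (deg-old C′ refl w)))

  sameComponent-restrict : ∀ {X C D} → C zero ≡ false → D zero ≡ false →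
    SameComponent H X C D → SameComponent G (X ∘ suc) (C ∘ suc) (D ∘ suc)
  sameComponent-restrict {C = C} C₀≡false _ (zero , _ , du , _) =
    ⊥-elim (du (deg-pendant-≡0 C C₀≡false))
  sameComponent-restrict {D = D} _ D₀≡false (suc _ , zero , _ , dw , _) =
    ⊥-elim (dw (deg-pendant-≡0 D D₀≡false))
  sameComponent-restrict {C = C} {D} C₀≡false D₀≡false (suc u , suc w , du , dw , r) =
    u , w , du ∘ trans (deg-old C C₀≡false u) , dw ∘ trans (deg-old D D₀≡false w) ,
    reach-restrict r

  sameComponent-extend : ∀ {X C D} → SameComponent G (X ∘ suc) C D →
    SameComponent H X (false Vector.∷ C) (false Vector.∷ D)
  sameComponent-extend {C = C} {D} (u , w , du , dw , r) =
    suc u , suc w , du ∘ trans (sym (deg-old (false Vector.∷ C) refl u)) ,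
    dw ∘ trans (sym (deg-old (false Vector.∷ D) refl w)) , reach-extend r

  sub-extend : ∀ {C X} → Sub G C (X ∘ suc) → Sub H (false Vector.∷ C) X
  sub-extend C⊆X zero    ()
  sub-extend C⊆X (suc e) C∋e = C⊆X e C∋e

  record Correspondence (QH : EdgeSet H → Set) (QG : EdgeSet G → Set) : Set where
    field
      avoids   : ∀ {C} → QH C → C zero ≡ false
      restrict : ∀ {C} → QH C → QG (C ∘ suc)
      extend   : ∀ {C} → QG C → QH (false Vector.∷ C)

  circleCorrespondence : Correspondence (Circle H) (Circle G)
  circleCorrespondence = record
    { avoids = circle-avoids-pendant ; restrict = circle-restrict ; extend = circle-extend }

  module _ {QH : EdgeSet H → Set} {QG : EdgeSet G → Set} (corr : Correspondence QH QG) where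
    open Correspondence corr

    noneContained-restrict : ∀ X → NoneContained H QH X ⇔ NoneContained G QG (X ∘ suc)
    noneContained-restrict X = mk⇔
      (λ none C QC C⊆X → none (false Vector.∷ C) (extend QC) (sub-extend C⊆X))
      (λ none C QC C⊆X → none (C ∘ suc) (restrict QC) (C⊆X ∘ suc))

    atMostOnePerComponent-restrict : ∀ X →
      AtMostOnePerComponent H QH X ⇔ AtMostOnePerComponent G QG (X ∘ suc)
    atMostOnePerComponent-restrict X = mk⇔ to from
      where
      to : AtMostOnePerComponent H QH X → AtMostOnePerComponent G QG (X ∘ suc)
      to unique C D QC QD C⊆X D⊆X same e =
        unique (false Vector.∷ C) (false Vector.∷ D) (extend QC) (extend QD)
          (sub-extend C⊆X) (sub-extend D⊆X) (sameComponent-extend same) (suc e)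
      from : AtMostOnePerComponent G QG (X ∘ suc) → AtMostOnePerComponent H QH X
      from unique C D QC QD C⊆X D⊆X same zero    = trans (avoids QC) (sym (avoids QD))
      from unique C D QC QD C⊆X D⊆X same (suc e) =
        unique (C ∘ suc) (D ∘ suc) (restrict QC) (restrict QD) (C⊆X ∘ suc) (D⊆X ∘ suc)
          (sameComponent-restrict (avoids QC) (avoids QD) same) e

  bicircular-restrict : ∀ X → BicircularIndep H X ⇔ BicircularIndep G (X ∘ suc)
  bicircular-restrict = atMostOnePerComponent-restrict circleCorrespondence

addPositivePendant : (S : SignedGraph) → Fin (nV (graph S)) → SignedGraph
addPositivePendant S w = record
  { graph = addPendant (graph S) w ; sign = Sign.+ Vector.∷ sign S }

module PendantSigned (S : SignedGraph) (w : Fin (nV (graph S))) where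
  open Pendant (graph S) w

  S⁺ : SignedGraph
  S⁺ = addPositivePendant S w

  signOf-restrict : ∀ C → C zero ≡ false → signOf S⁺ C ≡ signOf S (C ∘ suc)
  signOf-restrict C C₀≡false = trans
    (cong (λ s → s Sign.* foldr Sign._*_ Sign.+ (map g (tabulate suc)))
          (cong (λ b → if b then Sign.+ else Sign.+) C₀≡false))
    (cong (foldr Sign._*_ Sign.+) (trans (map-tabulate suc g) (sym (map-tabulate id (g ∘ suc)))))
    where
    g : Fin (nE H) → Sign
    g e = if C e then sign S⁺ e else Sign.+

  signedCircleCorrespondence : ∀ s →
    Correspondence (λ C → Circle H C × signOf S⁺ C ≡ s) (λ C → Circle (graph S) C × signOf S C ≡ s)
  signedCircleCorrespondence s = record
    { avoids   = λ (circle , _) → circle-avoids-pendant circle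
    ; restrict = λ {C} (circle , sign≡s) →
        circle-restrict circle , trans (sym (signOf-restrict C (circle-avoids-pendant circle))) sign≡s
    ; extend   = λ {C} (circle , sign≡s) →
        circle-extend circle , trans (signOf-restrict (false Vector.∷ C) refl) sign≡s
    }

  frame-restrict : ∀ Y → FrameIndep S⁺ Y ⇔ FrameIndep S (Y ∘ suc)
  frame-restrict Y =
    noneContained-restrict (signedCircleCorrespondence Sign.+) Y ×-⇔
    atMostOnePerComponent-restrict (signedCircleCorrespondence Sign.-) Y

Fin? : ∀ n → Fin n ⊎ ¬ Fin n
Fin? zero    = inj₂ ¬Fin0
Fin? (suc _) = inj₁ zero

suc-⤖ : ∀ {m n} → Fin m ⤖ Fin n → Fin (suc m) ⤖ Fin (suc n)
suc-⤖ f = mk⤖ (injective , strictlySurjective⇒surjective surjective)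
  where
  open Bijection f using (to)
  to′ = zero Vector.∷ (suc ∘ to)
  injective : ∀ {x y} → to′ x ≡ to′ y → x ≡ y
  injective {zero}  {zero}  _ = refl
  injective {suc x} {suc y} p = cong suc (Bijection.injective f (suc-injective p))
  surjective : ∀ y → ∃ λ x → to′ x ≡ y
  surjective zero    = zero , refl
  surjective (suc y) with x , tox≡y ← Bijection.strictlySurjective f y = suc x , cong suc tox≡y

signedGraphic-addPendant : ∀ G v (S : SignedGraph) (f : Fin (nE G) ⤖ Fin (nE (graph S))) →
  (∀ Y → FrameIndep S Y ⇔ BicircularIndep G (Y ∘ Bijection.to f)) → Fin (nV (graph S)) →
  SignedGraphic (BicircularIndep (addPendant G v))
signedGraphic-addPendant G v S f frame⇔bicircular w =
  addPositivePendant S w , suc-⤖ f , λ Y →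
    ⇔-sym (bicircular-restrict (Y ∘ Bijection.to (suc-⤖ f)))
      ⇔-∘ (frame⇔bicircular (Y ∘ suc) ⇔-∘ frame-restrict Y)
  where
  open Pendant G v using (bicircular-restrict)
  open PendantSigned S w using (frame-restrict)

circleFree-signedGraphic : ∀ G → (∀ C → ¬ Circle G C) → SignedGraphic (BicircularIndep G)
circleFree-signedGraphic G noCircle =
  record { graph = G ; sign = λ _ → Sign.+ } , ⤖-id _ , λ Y → mk⇔
    (λ _ C _ circle → ⊥-elim (noCircle C circle))
    (λ _ → (λ C (circle , _) → ⊥-elim (noCircle C circle)) ,
           (λ C _ (circle , _) → ⊥-elim (noCircle C circle)))

lemma7 : (G : Graph) (v : Fin (nV G)) →
    SignedGraphic (BicircularIndep G) →
    SignedGraphic (BicircularIndep (addPendant G v))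
lemma7 G v (S , f , frame⇔bicircular) with Fin? (nV (graph S))
... | inj₁ w        = signedGraphic-addPendant G v S f frame⇔bicircular w
... | inj₂ noVertex = circleFree-signedGraphic (addPendant G v) λ C circle →
  let (e , _) , _ = circle-restrict circle
  in noVertex (proj₁ (ends (graph S) (Bijection.to f e)))
  where
  open Pendant G v using (circle-restrict)
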